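{- For integers $n\geq 0$ let $Y_n(x)=\tfrac{1}{2}\left(U_{n+1}(x+\tfrac{1}{2})-U_n(x+\tfrac{1}{2})\right)$ and $Z_n(x)=\tfrac{1}{2}\left(U_{n+1}(x+\tfrac{1}{2})+U_n(x+\tfrac{1}{2})\right)$. For all integers $n\geq 1$ the polynomials $Y_{3n}(x)$ and $Z_{3n}(x)$ are reducible; specifically, with $y:=x+\tfrac{1}{2}$, \begin{align*} Y_{3n}(x)&=\tfrac{1}{2}\left(U_n(y)-U_{n-1}(y)\right)\left(U_{2n+1}(y)-U_{2n-1}(y)-1\right),\\ Z_{3n}(x)&=\tfrac{1}{2}\left(U_n(y)+U_{n-1}(y)\right)\left(U_{2n+1}(y)-U_{2n-1}(y)+1\right). \end{align*}
   Context: The Chebyshev polynomials of the second kind are defined by $U_0(y)=1$, $U_1(y)=2y$, $U_{n+1}(y)=2yU_n(y)-U_{n-1}(y)$. -}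

module Defs where

open import Algebra.Bundles using (CommutativeRing)
open import Data.Nat using (ℕ; zero; suc)

module ChebyshevU {c ℓ} (R : CommutativeRing c ℓ) where
  open CommutativeRing R

  U : ℕ → Carrier → Carrier
  U zero y = 1#
  U (suc zero) y = (1# + 1#) * y
  U (suc (suc n)) y = ((1# + 1#) * y) * U (suc n) y - U n y

  Y : (half : Carrier) → ℕ → Carrier → Carrier
  Y half n x = half * (U (suc n) (x + half) - U n (x + half))

  Z : (half : Carrier) → ℕ → Carrier → Carrier
  Z half n x = half * (U (suc n) (x + half) + U n (x + half))

module Submission where

-- Put V n = U_{n-1}(y) with U_{-1} = 0, so that V obeys the recurrence
-- V (n+2) = 2y V (n+1) - V n from n = 0 on.  Two classical facts about V
-- carry the argument:
--   * the addition formula  V (m+k+1) = V (m+1) V (k+1) - V m V k,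
--   * Cassini's identity    a² - 2y ab + b² = 1  for a = V (n+1), b = V n.
-- The addition formula writes U_{2n-1}, U_{2n}, U_{2n+1} and then U_{3n},
-- U_{3n+1} as polynomials in a, b and 2y; a polynomial identity shows
-- U_{3n+1} ∓ U_{3n} = (a ∓ b) (U_{2n+1} - U_{2n-1} ∓ C) with C the Cassini
-- form, and Cassini's identity replaces C by 1.  Multiplying by 1/2 gives
-- the theorem.

open import Defs
open import Algebra.Bundles using (CommutativeRing)
open import Data.Nat as N using (ℕ; _≤_; _∸_)
open import Data.Product using (_×_)

open import Algebra.Bundles using (RawRing)
open import Algebra.Solver.Ring.AlmostCommutativeRing
  using (fromCommutativeRing; _-Raw-AlmostCommutative⟶_; Induced-equivalence)
open import Data.Maybe using (just; nothing)
open import Data.Nat using (zero; suc)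
import Data.Nat.Properties as NP
open import Data.Nat.Tactic.RingSolver using (solve-∀)
open import Data.Product using (_,_)
open import Relation.Binary.Definitions using (WeaklyDecidable)
open import Relation.Binary.PropositionalEquality as ≡ using (_≡_)
open import Relation.Nullary using (yes; no)

module IntegerCoefficientSolver {c ℓ} (R : CommutativeRing c ℓ) where
  open CommutativeRing R
  open import Algebra.Properties.Ring ring using (x[y-z]≈xy-xz; [y-z]x≈yx-zx; -0#≈0#)
  open import Algebra.Properties.AbelianGroup +-abelianGroup
    using (⁻¹-∙-comm; ⁻¹-anti-homo‿-; x∙y⁻¹≈ε⇒x≈y)
  open import Algebra.Properties.CommutativeSemigroup +-commutativeSemigroup
    using (interchange)
  open import Algebra.Properties.Semiring.Mult semiring
    using (×-homo-+; ×1-homo-*) renaming (_×_ to _·_)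
  open import Relation.Binary.Reasoning.Setoid setoid

  -‿interchange : ∀ a b c d → (a + b) - (c + d) ≈ (a - c) + (b - d)
  -‿interchange a b c d = begin
    (a + b) + - (c + d)   ≈⟨ +-congˡ (⁻¹-∙-comm c d) ⟨
    (a + b) + (- c + - d) ≈⟨ interchange a b (- c) (- d) ⟩
    (a - c) + (b - d)     ∎

  -‿of-differences : ∀ a b c d → (a - b) - (c - d) ≈ (a + d) - (b + c)
  -‿of-differences a b c d = begin
    (a - b) - (c - d)  ≈⟨ +-congˡ (⁻¹-anti-homo‿- c d) ⟩
    (a - b) + (d - c)  ≈⟨ -‿interchange a d b c ⟨
    (a + d) - (b + c)  ∎

  *-of-differences : ∀ a b c d → (a - b) * (c - d) ≈ (a * c + b * d) - (a * d + b * c)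
  *-of-differences a b c d = begin
    (a - b) * (c - d)                   ≈⟨ [y-z]x≈yx-zx (c - d) a b ⟩
    a * (c - d) - b * (c - d)           ≈⟨ +-cong (x[y-z]≈xy-xz a c d) (-‿cong (x[y-z]≈xy-xz b c d)) ⟩
    (a * c - a * d) - (b * c - b * d)   ≈⟨ -‿of-differences (a * c) (a * d) (b * c) (b * d) ⟩
    (a * c + b * d) - (a * d + b * c)   ∎

  -‿cancel : ∀ a b c d → a + d ≈ c + b → a - b ≈ c - d
  -‿cancel a b c d a+d≈c+b = x∙y⁻¹≈ε⇒x≈y (a - b) (c - d) (begin
    (a - b) - (c - d)  ≈⟨ -‿of-differences a b c d ⟩
    (a + d) - (b + c)  ≈⟨ +-cong a+d≈c+b (-‿cong (+-comm b c)) ⟩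
    (c + b) - (c + b)  ≈⟨ -‿inverseʳ (c + b) ⟩
    0#                 ∎)

  -- Integers as formal differences of naturals: (p , q) stands for p - q.
  Difference : Set
  Difference = ℕ × ℕ

  -- Reduced representative: one of the two components is zero.  The solver
  -- compares evaluated normal forms syntactically, so coefficients must be
  -- kept reduced.
  reduce : ℕ → ℕ → Difference
  reduce p q = (p ∸ q , q ∸ p)

  differenceRing : RawRing _ _
  differenceRing = record
    { Carrier = Difference
    ; _≈_     = _≡_
    ; _+_     = λ { (p , q) (p′ , q′) → reduce (p N.+ p′) (q N.+ q′) }
    ; _*_     = λ { (p , q) (p′ , q′) → reduce (p N.* p′ N.+ q N.* q′) (p N.* q′ N.+ q N.* p′) }
    ; -_      = λ { (p , q) → (q , p) }
    ; 0#      = (0 , 0)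
    ; 1#      = (1 , 0)
    }

  ι : ℕ → Carrier
  ι n = n · 1#

  ⟪_⟫ : Difference → Carrier
  ⟪ p , q ⟫ = ι p - ι q

  ⟪⟫-cross : ∀ p q p′ q′ → p N.+ q′ ≡ p′ N.+ q → ⟪ p , q ⟫ ≈ ⟪ p′ , q′ ⟫
  ⟪⟫-cross p q p′ q′ p+q′≡p′+q = -‿cancel (ι p) (ι q) (ι p′) (ι q′) (begin
    ι p + ι q′      ≈⟨ ×-homo-+ 1# p q′ ⟨
    ι (p N.+ q′)    ≡⟨ ≡.cong ι p+q′≡p′+q ⟩
    ι (p′ N.+ q)    ≈⟨ ×-homo-+ 1# p′ q ⟩
    ι p′ + ι q      ∎)

  ∸-balance : ∀ p q → (p ∸ q) N.+ q ≡ p N.+ (q ∸ p)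
  ∸-balance zero    zero    = ≡.refl
  ∸-balance zero    (suc q) = ≡.refl
  ∸-balance (suc p) zero    = ≡.refl
  ∸-balance (suc p) (suc q) = ≡.trans (NP.+-suc (p ∸ q) q) (≡.cong suc (∸-balance p q))

  reduce-sound : ∀ p q → ⟪ reduce p q ⟫ ≈ ⟪ p , q ⟫
  reduce-sound p q = ⟪⟫-cross (p ∸ q) (q ∸ p) p q (∸-balance p q)

  homomorphism : differenceRing -Raw-AlmostCommutative⟶ fromCommutativeRing R
  homomorphism = record
    { ⟦_⟧    = ⟪_⟫
    ; +-homo = λ { (p , q) (p′ , q′) → begin
        ⟪ reduce (p N.+ p′) (q N.+ q′) ⟫  ≈⟨ reduce-sound (p N.+ p′) (q N.+ q′) ⟩
        ι (p N.+ p′) - ι (q N.+ q′)       ≈⟨ +-cong (×-homo-+ 1# p p′) (-‿cong (×-homo-+ 1# q q′)) ⟩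
        (ι p + ι p′) - (ι q + ι q′)       ≈⟨ -‿interchange (ι p) (ι p′) (ι q) (ι q′) ⟩
        (ι p - ι q) + (ι p′ - ι q′)       ∎ }
    ; *-homo = λ { (p , q) (p′ , q′) → begin
        ⟪ reduce (p N.* p′ N.+ q N.* q′) (p N.* q′ N.+ q N.* p′) ⟫
          ≈⟨ reduce-sound (p N.* p′ N.+ q N.* q′) (p N.* q′ N.+ q N.* p′) ⟩
        ι (p N.* p′ N.+ q N.* q′) - ι (p N.* q′ N.+ q N.* p′)
          ≈⟨ +-cong (ι-+-* p p′ q q′) (-‿cong (ι-+-* p q′ q p′)) ⟩
        (ι p * ι p′ + ι q * ι q′) - (ι p * ι q′ + ι q * ι p′)
          ≈⟨ *-of-differences (ι p) (ι q) (ι p′) (ι q′) ⟨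
        (ι p - ι q) * (ι p′ - ι q′)   ∎ }
    ; -‿homo = λ { (p , q) → sym (⁻¹-anti-homo‿- (ι p) (ι q)) }
    ; 0-homo = -‿inverseʳ 0#
    ; 1-homo = trans (+-cong (+-identityʳ 1#) -0#≈0#) (+-identityʳ 1#)
    }
    where
    ι-+-* : ∀ m n k l → ι (m N.* n N.+ k N.* l) ≈ ι m * ι n + ι k * ι l
    ι-+-* m n k l = trans (×-homo-+ 1# (m N.* n) (k N.* l)) (+-cong (×1-homo-* m n) (×1-homo-* k l))

  _≟_ : WeaklyDecidable (Induced-equivalence homomorphism)
  (p , q) ≟ (p′ , q′) with p N.+ q′ N.≟ p′ N.+ q
  ... | yes p+q′≡p′+q = just (⟪⟫-cross p q p′ q′ p+q′≡p′+q)
  ... | no _          = nothing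

  open import Algebra.Solver.Ring differenceRing (fromCommutativeRing R) homomorphism _≟_ public

double : ∀ n → 2 N.* n ≡ n N.+ n
double = solve-∀

double+1 : ∀ n → 2 N.* n N.+ 1 ≡ suc n N.+ n
double+1 = solve-∀

triple : ∀ n → 3 N.* n ≡ 2 N.* n N.+ n
triple = solve-∀

triple+1 : ∀ n → suc (3 N.* n) ≡ (2 N.* n N.+ 1) N.+ n
triple+1 = solve-∀

module Chebyshev {c ℓ} (R : CommutativeRing c ℓ) (y : CommutativeRing.Carrier R) where
  open CommutativeRing R
  open ChebyshevU R using (U)
  open IntegerCoefficientSolver R using (solve; _:=_; _:+_; _:-_; _:*_)
  open import Algebra.Properties.Ring ring using (-0#≈0#)
  open import Relation.Binary.Reasoning.Setoid setoid

  twoY : Carrier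
  twoY = (1# + 1#) * y

  -- V n = U_{n-1}(y) with U_{-1} = 0; after this shift the three-term
  -- recurrence holds from the very first index.
  V : ℕ → Carrier
  V zero    = 0#
  V (suc n) = U n y

  V-cong : ∀ {i j} → i ≡ j → V i ≈ V j
  V-cong ≡.refl = refl

  V-rec : ∀ n → V (2 N.+ n) ≈ twoY * V (1 N.+ n) - V n
  V-rec zero    = sym (trans (+-cong (*-identityʳ twoY) -0#≈0#) (+-identityʳ twoY))
  V-rec (suc n) = refl

  V-rec-backward : ∀ n → V n ≈ twoY * V (1 N.+ n) - V (2 N.+ n)
  V-rec-backward n = begin
    V n                                          ≈⟨ cancel (V n) (twoY * V (1 N.+ n)) ⟩
    twoY * V (1 N.+ n) - (twoY * V (1 N.+ n) - V n) ≈⟨ +-congˡ (-‿cong (V-rec n)) ⟨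
    twoY * V (1 N.+ n) - V (2 N.+ n)             ∎
    where
    cancel : ∀ v w → v ≈ w - (w - v)
    cancel = solve 2 (λ v w → v := w :- (w :- v)) refl

  V-addition : ∀ m k → V (1 N.+ (m N.+ k)) ≈ V (1 N.+ m) * V (1 N.+ k) - V m * V k
  V-addition zero k = sym (begin
    1# * V (1 N.+ k) - 0# * V k  ≈⟨ +-cong (*-identityˡ _) (-‿cong (zeroˡ (V k))) ⟩
    V (1 N.+ k) - 0#             ≈⟨ +-congˡ -0#≈0# ⟩
    V (1 N.+ k) + 0#             ≈⟨ +-identityʳ _ ⟩
    V (1 N.+ k)                  ∎)
  V-addition (suc m) k = begin
    V (2 N.+ (m N.+ k))                                     ≈⟨ V-cong (≡.cong suc (≡.sym (NP.+-suc m k))) ⟩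
    V (1 N.+ (m N.+ suc k))                                 ≈⟨ V-addition m (suc k) ⟩
    V (1 N.+ m) * V (2 N.+ k) - V m * V (1 N.+ k)           ≈⟨ +-congʳ (*-congˡ (V-rec k)) ⟩
    V (1 N.+ m) * (twoY * V (1 N.+ k) - V k) - V m * V (1 N.+ k)
      ≈⟨ shift (V (1 N.+ m)) (V m) (V (1 N.+ k)) (V k) twoY ⟩
    (twoY * V (1 N.+ m) - V m) * V (1 N.+ k) - V (1 N.+ m) * V k ≈⟨ +-congʳ (*-congʳ (V-rec m)) ⟨
    V (2 N.+ m) * V (1 N.+ k) - V (1 N.+ m) * V k           ∎
    where
    shift : ∀ a b c d t → a * (t * c - d) - b * c ≈ (t * a - b) * c - a * d
    shift = solve 5 (λ a b c d t → a :* (t :* c :- d) :- b :* c := (t :* a :- b) :* c :- a :* d) refl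

  cassiniForm : Carrier → Carrier → Carrier
  cassiniForm a b = a * a - twoY * a * b + b * b

  -- Cassini's identity  U_n² - 2y U_n U_{n-1} + U_{n-1}² = 1: the form is
  -- invariant under the step (a , b) ↦ (2y·a - b , a).
  cassini : ∀ n → cassiniForm (V (1 N.+ n)) (V n) ≈ 1#
  cassini zero = begin
    cassiniForm 1# 0#                 ≈⟨ regroup 1# 0# twoY ⟩
    1# * 1# + 0# * (0# - twoY * 1#)   ≈⟨ +-cong (*-identityˡ 1#) (zeroˡ _) ⟩
    1# + 0#                           ≈⟨ +-identityʳ 1# ⟩
    1#                                ∎
    where
    regroup : ∀ a b t → a * a - t * a * b + b * b ≈ a * a + b * (b - t * a)
    regroup = solve 3 (λ a b t → a :* a :- t :* a :* b :+ b :* b := a :* a :+ b :* (b :- t :* a)) refl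
  cassini (suc n) = begin
    cassiniForm (V (2 N.+ n)) (V (1 N.+ n))
      ≈⟨ +-congʳ (+-cong (*-cong (V-rec n) (V-rec n)) (-‿cong (*-congʳ (*-congˡ (V-rec n))))) ⟩
    cassiniForm (twoY * V (1 N.+ n) - V n) (V (1 N.+ n))          ≈⟨ step (V (1 N.+ n)) (V n) twoY ⟩
    cassiniForm (V (1 N.+ n)) (V n)                               ≈⟨ cassini n ⟩
    1#                                                            ∎
    where
    step : ∀ a b t → (t * a - b) * (t * a - b) - t * (t * a - b) * a + a * a ≈ a * a - t * a * b + b * b
    step = solve 3 (λ a b t → (t :* a :- b) :* (t :* a :- b) :- t :* (t :* a :- b) :* a :+ a :* a
                              := a :* a :- t :* a :* b :+ b :* b) refl

  -- Writing a = U_n, b = U_{n-1} and t = 2y, the addition formula and the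
  -- recurrence express U_{2n-1}, U_{2n}, U_{2n+1} as these polynomials.
  w₀ : Carrier → Carrier → Carrier
  w₀ a b = a * a - b * b

  w₊ : Carrier → Carrier → Carrier → Carrier
  w₊ t a b = (t * a - b) * a - a * b

  w₋ : Carrier → Carrier → Carrier → Carrier
  w₋ t a b = t * w₀ a b - w₊ t a b

  -- The two polynomial identities behind the factorisation: modulo the
  -- Cassini form, U_{3n+1} ∓ U_{3n} factors through U_n ∓ U_{n-1}.
  difference-factors : ∀ t a b →
    (w₊ t a b * a - w₀ a b * b) - (w₀ a b * a - w₋ t a b * b)
      ≈ (a - b) * ((w₊ t a b - w₋ t a b) - (a * a - t * a * b + b * b))
  difference-factors = solve 3 (λ t a b →
    let q = a :* a :- b :* b
        p = (t :* a :- b) :* a :- a :* b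
        z = t :* q :- p
    in (p :* a :- q :* b) :- (q :* a :- z :* b)
         := (a :- b) :* ((p :- z) :- (a :* a :- t :* a :* b :+ b :* b))) refl

  sum-factors : ∀ t a b →
    (w₊ t a b * a - w₀ a b * b) + (w₀ a b * a - w₋ t a b * b)
      ≈ (a + b) * ((w₊ t a b - w₋ t a b) + (a * a - t * a * b + b * b))
  sum-factors = solve 3 (λ t a b →
    let q = a :* a :- b :* b
        p = (t :* a :- b) :* a :- a :* b
        z = t :* q :- p
    in (p :* a :- q :* b) :+ (q :* a :- z :* b)
         := (a :+ b) :* ((p :- z) :+ (a :* a :- t :* a :* b :+ b :* b))) refl

  module Tripling (n : ℕ) where
    a b : Carrier
    a = V (1 N.+ n)
    b = V n

    even-expand : V (1 N.+ 2 N.* n) ≈ w₀ a b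
    even-expand = trans (V-cong (≡.cong suc (double n))) (V-addition n n)

    odd-expand : V (1 N.+ (2 N.* n N.+ 1)) ≈ w₊ twoY a b
    odd-expand = begin
      V (1 N.+ (2 N.* n N.+ 1))   ≈⟨ V-cong (≡.cong suc (double+1 n)) ⟩
      V (1 N.+ (suc n N.+ n))     ≈⟨ V-addition (suc n) n ⟩
      V (2 N.+ n) * a - a * b     ≈⟨ +-congʳ (*-congʳ (V-rec n)) ⟩
      w₊ twoY a b                 ∎

    odd-expand-below : V (2 N.* n) ≈ w₋ twoY a b
    odd-expand-below = begin
      V (2 N.* n)                                          ≈⟨ V-rec-backward (2 N.* n) ⟩
      twoY * V (1 N.+ 2 N.* n) - V (2 N.+ 2 N.* n)         ≈⟨ +-congˡ (-‿cong (V-cong (≡.cong suc (NP.+-comm 1 (2 N.* n))))) ⟩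
      twoY * V (1 N.+ 2 N.* n) - V (1 N.+ (2 N.* n N.+ 1)) ≈⟨ +-cong (*-congˡ even-expand) (-‿cong odd-expand) ⟩
      w₋ twoY a b                                          ∎

    upper-expand : V (2 N.+ 3 N.* n) ≈ w₊ twoY a b * a - w₀ a b * b
    upper-expand = begin
      V (2 N.+ 3 N.* n)                                       ≈⟨ V-cong (≡.cong suc (triple+1 n)) ⟩
      V (1 N.+ ((2 N.* n N.+ 1) N.+ n))                       ≈⟨ V-addition (2 N.* n N.+ 1) n ⟩
      V (1 N.+ (2 N.* n N.+ 1)) * a - V (2 N.* n N.+ 1) * b  ≈⟨ +-cong (*-congʳ odd-expand) (-‿cong (*-congʳ (V-cong (NP.+-comm (2 N.* n) 1)))) ⟩
      w₊ twoY a b * a - V (1 N.+ 2 N.* n) * b                 ≈⟨ +-congˡ (-‿cong (*-congʳ even-expand)) ⟩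
      w₊ twoY a b * a - w₀ a b * b                            ∎

    lower-expand : V (1 N.+ 3 N.* n) ≈ w₀ a b * a - w₋ twoY a b * b
    lower-expand = begin
      V (1 N.+ 3 N.* n)                                  ≈⟨ V-cong (≡.cong suc (triple n)) ⟩
      V (1 N.+ (2 N.* n N.+ n))                          ≈⟨ V-addition (2 N.* n) n ⟩
      V (1 N.+ 2 N.* n) * a - V (2 N.* n) * b            ≈⟨ +-cong (*-congʳ even-expand) (-‿cong (*-congʳ odd-expand-below)) ⟩
      w₀ a b * a - w₋ twoY a b * b                       ∎

    back-substitute : (w₊ twoY a b - w₋ twoY a b) ≈ (V (1 N.+ (2 N.* n N.+ 1)) - V (2 N.* n))
    back-substitute = sym (+-cong odd-expand (-‿cong odd-expand-below))

    tripling-difference : V (2 N.+ 3 N.* n) - V (1 N.+ 3 N.* n) ≈ (a - b) * ((V (1 N.+ (2 N.* n N.+ 1)) - V (2 N.* n)) - 1#)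
    tripling-difference = begin
      V (2 N.+ 3 N.* n) - V (1 N.+ 3 N.* n)                          ≈⟨ +-cong upper-expand (-‿cong lower-expand) ⟩
      (w₊ twoY a b * a - w₀ a b * b) - (w₀ a b * a - w₋ twoY a b * b) ≈⟨ difference-factors twoY a b ⟩
      (a - b) * ((w₊ twoY a b - w₋ twoY a b) - cassiniForm a b)       ≈⟨ *-congˡ (+-cong back-substitute (-‿cong (cassini n))) ⟩
      (a - b) * ((V (1 N.+ (2 N.* n N.+ 1)) - V (2 N.* n)) - 1#)      ∎

    tripling-sum : V (2 N.+ 3 N.* n) + V (1 N.+ 3 N.* n) ≈ (a + b) * ((V (1 N.+ (2 N.* n N.+ 1)) - V (2 N.* n)) + 1#)
    tripling-sum = begin
      V (2 N.+ 3 N.* n) + V (1 N.+ 3 N.* n)                          ≈⟨ +-cong upper-expand lower-expand ⟩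
      (w₊ twoY a b * a - w₀ a b * b) + (w₀ a b * a - w₋ twoY a b * b) ≈⟨ sum-factors twoY a b ⟩
      (a + b) * ((w₊ twoY a b - w₋ twoY a b) + cassiniForm a b)       ≈⟨ *-congˡ (+-cong back-substitute (cassini n)) ⟩
      (a + b) * ((V (1 N.+ (2 N.* n N.+ 1)) - V (2 N.* n)) + 1#)      ∎

-- For n ≥ 1, U_{n-1} = V n and U_{2n-1} = V (2n) hold by computation, so the
-- statement is the tripling formulas multiplied by 1/2.
proposition3p3 : ∀ {c ℓ} (R : CommutativeRing c ℓ) →
    let open CommutativeRing R in
    let open ChebyshevU R in
    (half : Carrier) → half * (1# + 1#) ≈ 1# →
    (n : ℕ) → 1 ≤ n → (x : Carrier) →
    let y = x + half in
    (Y half (3 N.* n) x ≈ half * ((U n y - U (n ∸ 1) y) * ((U (2 N.* n N.+ 1) y - U (2 N.* n ∸ 1) y) - 1#)))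
    × (Z half (3 N.* n) x ≈ half * ((U n y + U (n ∸ 1) y) * ((U (2 N.* n N.+ 1) y - U (2 N.* n ∸ 1) y) + 1#)))
proposition3p3 R half _ zero () x
proposition3p3 R half _ (suc m) _ x = *-congˡ tripling-difference , *-congˡ tripling-sum
  where
  open CommutativeRing R
  open Chebyshev R (x + half)
  open Tripling (suc m)
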